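{- Let $T$ be a finite tree with $n \ge 4$ vertices. Then $T$ has a redundant identifying code if and only if every support vertex $v$ of $T$ has $\deg(v) \ge 3$.
   Context: $N[v]$ denotes the closed neighborhood of $v$ and $\Delta$ symmetric difference. A set $S \subseteq V(T)$ is a redundant identifying code if every vertex $v$ satisfies $|N[v] \cap S| \ge 2$ and every pair of distinct vertices $u,v$ satisfies $|(N[u]\cap S)\,\Delta\,(N[v]\cap S)| \ge 2$. A vertex $u$ with exactly one neighbor $v$ is a leaf, and $v$ is then called a support vertex. -}

module Defs where

open import Data.Nat using (ℕ; suc; _≤_; _∸_)
open import Data.Bool using (Bool; true; false; _∨_; if_then_else_)
open import Data.Fin using (Fin; _≟_)
open import Data.Fin.Subset using (Subset; inside; outside; _∩_; _∪_; _─_; ∣_∣; _∈_)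
open import Data.Vec using (tabulate)
open import Data.List using (List; []; _∷_; length)
open import Data.List.Relation.Unary.AllPairs using (AllPairs)
open import Data.Empty using (⊥)
open import Data.Product using (Σ; _×_; ∃)
open import Relation.Nullary using (¬_; does)
open import Relation.Binary.PropositionalEquality using (_≡_; _≢_)

record Graph (n : ℕ) : Set where
  field
    adj   : Fin n → Fin n → Bool
    sym   : ∀ u v → adj u v ≡ adj v u
    irrefl : ∀ v → adj v v ≡ false
open Graph public

module _ {n : ℕ} (G : Graph n) where

  Adj : Fin n → Fin n → Set
  Adj u v = adj G u v ≡ true

  data IsWalk : List (Fin n) → Set where
    single : ∀ v → IsWalk (v ∷ [])
    step   : ∀ {u v vs} → Adj u v → IsWalk (v ∷ vs) → IsWalk (u ∷ v ∷ vs)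

  data Last : List (Fin n) → Fin n → Set where
    last-single : ∀ v → Last (v ∷ []) v
    last-cons   : ∀ {u vs w} → Last vs w → Last (u ∷ vs) w

  WalkBetween : Fin n → Fin n → List (Fin n) → Set
  WalkBetween u v (x ∷ xs) = (x ≡ u) × IsWalk (x ∷ xs) × Last (x ∷ xs) v
  WalkBetween u v [] = ⊥

  Connected : Set
  Connected = ∀ u v → ∃ λ w → WalkBetween u v w

  IsCycle : List (Fin n) → Set
  IsCycle vs = Σ (Fin n) λ v₀ → Σ (Fin n) λ vₖ →
    (3 ≤ length vs) × AllPairs _≢_ vs × WalkBetween v₀ vₖ vs × Adj vₖ v₀

  Acyclic : Set
  Acyclic = ∀ vs → ¬ IsCycle vs

  IsTree : Set
  IsTree = Connected × Acyclic

  N : Fin n → Subset n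
  N v = tabulate λ w → if adj G v w then inside else outside

  N[_] : Fin n → Subset n
  N[ v ] = tabulate λ w → if does (w ≟ v) ∨ adj G v w then inside else outside

  deg : Fin n → ℕ
  deg v = ∣ N v ∣

  IsLeaf : Fin n → Set
  IsLeaf u = deg u ≡ 1

  IsSupport : Fin n → Set
  IsSupport v = ∃ λ u → IsLeaf u × Adj u v

  _Δ_ : Subset n → Subset n → Subset n
  A Δ B = (A ─ B) ∪ (B ─ A)

  IsRedundantIdentifyingCode : Subset n → Set
  IsRedundantIdentifyingCode S =
    (∀ v → 2 ≤ ∣ N[ v ] ∩ S ∣) ×
    (∀ u v → u ≢ v → 2 ≤ ∣ (N[ u ] ∩ S) Δ (N[ v ] ∩ S) ∣)

  HasRedundantIdentifyingCode : Set
  HasRedundantIdentifyingCode = ∃ λ S → IsRedundantIdentifyingCode S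

-- A leaf u with support vertex v has N[u] = {u, v} ⊆ N[v], so on any code S the traces
-- N[u] ∩ S and N[v] ∩ S differ only inside N(v) − u; separating u from v twice forces
-- deg v ≥ 3. Conversely, if every support vertex has degree at least 3, the whole vertex
-- set is a redundant identifying code: each vertex has a neighbour; non-adjacent u, v are
-- separated by u and v themselves; and for an edge uv the sets N(u) − v and N(v) − u lie in
-- N[u] Δ N[v] and are disjoint (a tree has no triangle), of total size deg u + deg v − 2,
-- which is at least 2 because a leaf endpoint forces the other endpoint to have degree ≥ 3.

module Submission where

open import Defs hiding (sym)
open import Data.Nat using (ℕ; suc; zero; _+_; _≤_; z≤n; s≤s)
open import Data.Nat.Properties using (+-suc; ≤-trans; m≤m+n; m≤n+m; ≤-pred; module ≤-Reasoning)
open import Data.Bool as Bool using (Bool; true; _∨_; if_then_else_)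
open import Data.Bool.Properties using (∨-zeroʳ)
open import Data.Fin using (Fin; _≟_; punchIn) renaming (zero to fzero)
open import Data.Fin.Properties using (punchInᵢ≢i)
open import Data.Fin.Subset
  using (Subset; inside; outside; ⊤; _∩_; _∪_; _─_; _-_; ∣_∣; _∈_; _∉_; _⊆_)
open import Data.Fin.Subset.Properties
  using ( p─⊥≡p; x∈p∧x∉q⇒x∈p─q; x∈p∧x≢y⇒x∈p-y; x∉⁅y⁆⇒x≢y
        ; x∈p∪q⁺; x∈p∪q⁻; x∈p∩q⁺; x∈p∩q⁻; p─q⊆p; p⊆q⇒∣p∣≤∣q∣; ∩-identityʳ)
open import Data.Vec using ([]; _∷_; tabulate; lookup; here; there)
open import Data.Vec.Properties using (lookup∘tabulate; []=⇒lookup; lookup⇒[]=)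
open import Data.List using ([]; _∷_)
open import Data.List.Relation.Unary.All using ([]; _∷_)
open import Data.List.Relation.Unary.AllPairs using ([]; _∷_)
open import Data.Empty using (⊥)
open import Data.Sum as Sum using (_⊎_; inj₁; inj₂)
open import Data.Product using (∃; _,_)
open import Relation.Nullary using (¬_; does; yes; no; contradiction)
open import Relation.Nullary.Decidable using (dec-true)
open import Relation.Binary.PropositionalEquality
  using (_≡_; _≢_; refl; sym; trans; cong; subst; module ≡-Reasoning)
open import Function using (_∘_)
open import Function.Bundles using (_⇔_; mk⇔)

private
  variable
    n : ℕ

x∈p─q⇒x∉q : ∀ {p q : Subset n} {x} → x ∈ p ─ q → x ∉ q
x∈p─q⇒x∉q {p = _ ∷ _} ()      here
x∈p─q⇒x∉q {p = _ ∷ _} (there x∈p─q) (there x∈q) = x∈p─q⇒x∉q x∈p─q x∈q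

∣p∣≡1+∣p-x∣ : ∀ {p : Subset n} {x} → x ∈ p → ∣ p ∣ ≡ suc ∣ p - x ∣
∣p∣≡1+∣p-x∣ {p = inside ∷ p}  here         = cong (suc ∘ ∣_∣) (sym (p─⊥≡p p))
∣p∣≡1+∣p-x∣ {p = inside ∷ p}  (there x∈p) = cong suc (∣p∣≡1+∣p-x∣ x∈p)
∣p∣≡1+∣p-x∣ {p = outside ∷ p} (there x∈p) = ∣p∣≡1+∣p-x∣ x∈p

x∈p∧y∈p∧x≢y⇒2≤∣p∣ : ∀ {p : Subset n} {x y} → x ∈ p → y ∈ p → x ≢ y → 2 ≤ ∣ p ∣
x∈p∧y∈p∧x≢y⇒2≤∣p∣ {x = x} x∈p y∈p x≢y rewrite ∣p∣≡1+∣p-x∣ x∈p =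
  s≤s (subst (1 ≤_) (sym (∣p∣≡1+∣p-x∣ y∈p-x)) (s≤s z≤n))
  where y∈p-x = x∈p∧x≢y⇒x∈p-y y∈p (x≢y ∘ sym)

Disjoint : Subset n → Subset n → Set
Disjoint p q = ∀ {x} → x ∈ p → x ∉ q

Disjoint-tail : ∀ {s t} {p q : Subset n} → Disjoint (s ∷ p) (t ∷ q) → Disjoint p q
Disjoint-tail disjoint x∈p x∈q = disjoint (there x∈p) (there x∈q)

∣p∪q∣≡∣p∣+∣q∣ : ∀ {p q : Subset n} → Disjoint p q → ∣ p ∪ q ∣ ≡ ∣ p ∣ + ∣ q ∣
∣p∪q∣≡∣p∣+∣q∣ {p = []}          {[]}          _ = refl
∣p∪q∣≡∣p∣+∣q∣ {p = inside  ∷ p} {inside  ∷ q} disjoint = contradiction here (disjoint here)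
∣p∪q∣≡∣p∣+∣q∣ {p = inside  ∷ p} {outside ∷ q} disjoint = cong suc (∣p∪q∣≡∣p∣+∣q∣ (Disjoint-tail disjoint))
∣p∪q∣≡∣p∣+∣q∣ {p = outside ∷ p} {inside  ∷ q} disjoint =
  trans (cong suc (∣p∪q∣≡∣p∣+∣q∣ (Disjoint-tail disjoint))) (sym (+-suc ∣ p ∣ ∣ q ∣))
∣p∪q∣≡∣p∣+∣q∣ {p = outside ∷ p} {outside ∷ q} disjoint = ∣p∪q∣≡∣p∣+∣q∣ (Disjoint-tail disjoint)

module _ (f : Fin n → Bool) {x : Fin n} where

  private
    χ : Subset n
    χ = tabulate (λ w → if f w then inside else outside)

  ∈-tabulate-if⁺ : f x ≡ true → x ∈ χ
  ∈-tabulate-if⁺ fx≡true = lookup⇒[]= x χ (begin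
    lookup χ x                       ≡⟨ lookup∘tabulate _ x ⟩
    (if f x then inside else outside) ≡⟨ cong (if_then inside else outside) fx≡true ⟩
    inside                           ∎)
    where open ≡-Reasoning

  ∈-tabulate-if⁻ : x ∈ χ → f x ≡ true
  ∈-tabulate-if⁻ x∈χ = if-inside (f x) (trans (sym (lookup∘tabulate _ x)) ([]=⇒lookup x∈χ))
    where
    if-inside : ∀ b → (if b then inside else outside) ≡ inside → b ≡ true
    if-inside true _ = refl

p⊆q⇒[p∩r]Δ[q∩r]⊆q─p : ∀ {p q r : Subset n} → p ⊆ q → (p ∩ r ─ q ∩ r) ∪ (q ∩ r ─ p ∩ r) ⊆ q ─ p
p⊆q⇒[p∩r]Δ[q∩r]⊆q─p {p = p} {q} {r} p⊆q x∈Δ with x∈p∪q⁻ (p ∩ r ─ q ∩ r) (q ∩ r ─ p ∩ r) x∈Δ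
... | inj₁ x∈p∩r─q∩r =
  let x∈p , x∈r = x∈p∩q⁻ p r (p─q⊆p _ _ x∈p∩r─q∩r)
  in contradiction (x∈p∩q⁺ (p⊆q x∈p , x∈r)) (x∈p─q⇒x∉q x∈p∩r─q∩r)
... | inj₂ x∈q∩r─p∩r =
  let x∈q , x∈r = x∈p∩q⁻ q r (p─q⊆p _ _ x∈q∩r─p∩r)
  in x∈p∧x∉q⇒x∈p─q x∈q (λ x∈p → x∈p─q⇒x∉q x∈q∩r─p∩r (x∈p∩q⁺ (x∈p , x∈r)))

∪-mono-⊆ : ∀ {p q r s : Subset n} → p ⊆ r → q ⊆ s → p ∪ q ⊆ r ∪ s
∪-mono-⊆ {p = p} {q} p⊆r q⊆s = x∈p∪q⁺ ∘ Sum.map p⊆r q⊆s ∘ x∈p∪q⁻ p q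

2≤a+b : ∀ {a b} → (a ≡ 0 → 2 ≤ b) → (b ≡ 0 → 2 ≤ a) → 2 ≤ a + b
2≤a+b {zero}          2≤b _   = 2≤b refl
2≤a+b {suc a} {zero}  _   2≤a = ≤-trans (2≤a refl) (m≤m+n (suc a) 0)
2≤a+b {suc a} {suc b} _   _   = s≤s (≤-trans (s≤s z≤n) (m≤n+m (suc b) a))

another : 2 ≤ n → (v : Fin n) → ∃ λ w → w ≢ v
another (s≤s (s≤s _)) v = punchIn v fzero , punchInᵢ≢i v fzero

module _ (G : Graph n) where

  SupportsHaveDegree≥3 : Set
  SupportsHaveDegree≥3 = ∀ v → IsSupport G v → 3 ≤ deg G v

  Adj-sym : ∀ {u v} → Adj G u v → Adj G v u
  Adj-sym {u} {v} u~v = trans (Graph.sym G v u) u~v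

  Adj⇒≢ : ∀ {u v} → Adj G u v → u ≢ v
  Adj⇒≢ {u} u~u refl = contradiction (trans (sym u~u) (irrefl G u)) λ ()

  ∈N⁺ : ∀ {v w} → Adj G v w → w ∈ N G v
  ∈N⁺ {v} = ∈-tabulate-if⁺ (adj G v)

  ∈N⁻ : ∀ {v w} → w ∈ N G v → Adj G v w
  ∈N⁻ {v} = ∈-tabulate-if⁻ (adj G v)

  v∈N[v] : ∀ {v} → v ∈ N[_] G v
  v∈N[v] {v} = ∈-tabulate-if⁺ _ (cong (_∨ adj G v v) (dec-true (v ≟ v) refl))

  ∈N[]⁺ : ∀ {v w} → Adj G v w → w ∈ N[_] G v
  ∈N[]⁺ {v} {w} v~w = ∈-tabulate-if⁺ _ (trans (cong (does (w ≟ v) ∨_) v~w) (∨-zeroʳ _))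

  ∈N[]⁻ : ∀ {v w} → w ∈ N[_] G v → w ≡ v ⊎ Adj G v w
  ∈N[]⁻ {v} {w} w∈N[v] with w ≟ v | ∈-tabulate-if⁻ (λ x → does (x ≟ v) ∨ adj G v x) w∈N[v]
  ... | yes w≡v | _    = inj₁ w≡v
  ... | no _    | v~w = inj₂ v~w

  leaf-neighbour-unique : ∀ {u v w} → IsLeaf G u → Adj G u v → Adj G u w → w ≡ v
  leaf-neighbour-unique {v = v} {w} u-leaf u~v u~w with w ≟ v
  ... | yes w≡v = w≡v
  ... | no w≢v  = contradiction (subst (2 ≤_) u-leaf (x∈p∧y∈p∧x≢y⇒2≤∣p∣ (∈N⁺ u~w) (∈N⁺ u~v) w≢v))
                                λ { (s≤s ()) }

  leaf⇒N[u]⊆N[v] : ∀ {u v} → IsLeaf G u → Adj G u v → N[_] G u ⊆ N[_] G v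
  leaf⇒N[u]⊆N[v] u-leaf u~v x∈N[u] with ∈N[]⁻ x∈N[u]
  ... | inj₁ refl = ∈N[]⁺ (Adj-sym u~v)
  ... | inj₂ u~x  = subst (_∈ N[_] G _) (sym (leaf-neighbour-unique u-leaf u~v u~x)) v∈N[v]

  N[v]─N[u]⊆Nv-u : ∀ {u v} → Adj G u v → N[_] G v ─ N[_] G u ⊆ N G v - u
  N[v]─N[u]⊆Nv-u u~v x∈N[v]─N[u] with ∈N[]⁻ (p─q⊆p _ _ x∈N[v]─N[u])
  ... | inj₁ refl = contradiction (∈N[]⁺ u~v) (x∈p─q⇒x∉q x∈N[v]─N[u])
  ... | inj₂ v~x  = x∈p∧x≢y⇒x∈p-y (∈N⁺ v~x) λ { refl → x∈p─q⇒x∉q x∈N[v]─N[u] v∈N[v] }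

  deg≡1+∣N-v∣ : ∀ {u v} → Adj G u v → deg G u ≡ suc ∣ N G u - v ∣
  deg≡1+∣N-v∣ u~v = ∣p∣≡1+∣p-x∣ (∈N⁺ u~v)

  IsRedundantIdentifyingCode⇒SupportsHaveDegree≥3 :
    ∀ {S} → IsRedundantIdentifyingCode G S → SupportsHaveDegree≥3
  IsRedundantIdentifyingCode⇒SupportsHaveDegree≥3 {S} (_ , separating) v (u , u-leaf , u~v) = begin
    3                                                     ≤⟨ s≤s (separating u v (Adj⇒≢ u~v)) ⟩
    suc ∣ (N[ u ]∩S ─ N[ v ]∩S) ∪ (N[ v ]∩S ─ N[ u ]∩S) ∣ ≤⟨ s≤s (p⊆q⇒∣p∣≤∣q∣ Δ⊆Nv-u) ⟩
    suc ∣ N G v - u ∣                                     ≡⟨ sym (deg≡1+∣N-v∣ (Adj-sym u~v)) ⟩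
    deg G v                                               ∎
    where
    open ≤-Reasoning
    N[_]∩S : Fin _ → Subset _
    N[ x ]∩S = N[_] G x ∩ S
    Δ⊆Nv-u : (N[ u ]∩S ─ N[ v ]∩S) ∪ (N[ v ]∩S ─ N[ u ]∩S) ⊆ N G v - u
    Δ⊆Nv-u = N[v]─N[u]⊆Nv-u u~v ∘ p⊆q⇒[p∩r]Δ[q∩r]⊆q─p (leaf⇒N[u]⊆N[v] u-leaf u~v)

  TriangleFree : Set
  TriangleFree = ∀ {u v w} → Adj G u v → Adj G v w → Adj G u w → ⊥

  nonadjacent-separated : ∀ {u v} → u ≢ v → ¬ Adj G u v →
                          2 ≤ ∣ (N[_] G u ─ N[_] G v) ∪ (N[_] G v ─ N[_] G u) ∣
  nonadjacent-separated u≢v u≁v = x∈p∧y∈p∧x≢y⇒2≤∣p∣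
    (x∈p∪q⁺ (inj₁ (x∈p∧x∉q⇒x∈p─q v∈N[v] (x∉N[y] u≢v u≁v))))
    (x∈p∪q⁺ (inj₂ (x∈p∧x∉q⇒x∈p─q v∈N[v] (x∉N[y] (u≢v ∘ sym) (u≁v ∘ Adj-sym)))))
    u≢v
    where
    x∉N[y] : ∀ {x y} → x ≢ y → ¬ Adj G x y → x ∉ N[_] G y
    x∉N[y] x≢y x≁y = Sum.[ x≢y , x≁y ∘ Adj-sym ] ∘ ∈N[]⁻

  module _ (triangle-free : TriangleFree) where

    Nu-v⊆N[u]─N[v] : ∀ {u v} → Adj G u v → N G u - v ⊆ N[_] G u ─ N[_] G v
    Nu-v⊆N[u]─N[v] u~v w∈Nu-v =
      x∈p∧x∉q⇒x∈p─q (∈N[]⁺ u~w) (Sum.[ w≢v , (λ v~w → triangle-free u~v v~w u~w) ] ∘ ∈N[]⁻)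
      where
      u~w = ∈N⁻ (p─q⊆p _ _ w∈Nu-v)
      w≢v = x∉⁅y⁆⇒x≢y (x∈p─q⇒x∉q w∈Nu-v)

    Nu-v-disjoint-Nv-u : ∀ {u v} → Adj G u v → Disjoint (N G u - v) (N G v - u)
    Nu-v-disjoint-Nv-u u~v w∈Nu-v w∈Nv-u =
      triangle-free u~v (∈N⁻ (p─q⊆p _ _ w∈Nv-u)) (∈N⁻ (p─q⊆p _ _ w∈Nu-v))

    adjacent-separated : SupportsHaveDegree≥3 → ∀ {u v} → Adj G u v →
                         2 ≤ ∣ (N[_] G u ─ N[_] G v) ∪ (N[_] G v ─ N[_] G u) ∣
    adjacent-separated supports-have-degree≥3 {u} {v} u~v = begin
      2                             ≤⟨ 2≤a+b (∣Nx-y∣≡0⇒2≤∣Ny-x∣ u~v) (∣Nx-y∣≡0⇒2≤∣Ny-x∣ (Adj-sym u~v)) ⟩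
      ∣ N G u - v ∣ + ∣ N G v - u ∣ ≡⟨ sym (∣p∪q∣≡∣p∣+∣q∣ (Nu-v-disjoint-Nv-u u~v)) ⟩
      ∣ (N G u - v) ∪ (N G v - u) ∣ ≤⟨ p⊆q⇒∣p∣≤∣q∣ (∪-mono-⊆ (Nu-v⊆N[u]─N[v] u~v)
                                                            (Nu-v⊆N[u]─N[v] (Adj-sym u~v))) ⟩
      ∣ (N[_] G u ─ N[_] G v) ∪ (N[_] G v ─ N[_] G u) ∣ ∎
      where
      open ≤-Reasoning
      ∣Nx-y∣≡0⇒2≤∣Ny-x∣ : ∀ {x y} → Adj G x y → ∣ N G x - y ∣ ≡ 0 → 2 ≤ ∣ N G y - x ∣
      ∣Nx-y∣≡0⇒2≤∣Ny-x∣ {x} {y} x~y ∣Nx-y∣≡0 =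
        ≤-pred (subst (3 ≤_) (deg≡1+∣N-v∣ (Adj-sym x~y)) (supports-have-degree≥3 y (x , x-leaf , x~y)))
        where
        x-leaf : IsLeaf G x
        x-leaf = trans (deg≡1+∣N-v∣ x~y) (cong suc ∣Nx-y∣≡0)

    ⊤-isRedundantIdentifyingCode : (∀ v → ∃ (Adj G v)) → SupportsHaveDegree≥3 →
                                   IsRedundantIdentifyingCode G ⊤
    ⊤-isRedundantIdentifyingCode has-neighbour supports-have-degree≥3 = dominating , separating
      where
      dominating : ∀ v → 2 ≤ ∣ N[_] G v ∩ ⊤ ∣
      dominating v rewrite ∩-identityʳ (N[_] G v) =
        let w , v~w = has-neighbour v in x∈p∧y∈p∧x≢y⇒2≤∣p∣ v∈N[v] (∈N[]⁺ v~w) (Adj⇒≢ v~w)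

      separating : ∀ u v → u ≢ v →
                   2 ≤ ∣ (N[_] G u ∩ ⊤ ─ N[_] G v ∩ ⊤) ∪ (N[_] G v ∩ ⊤ ─ N[_] G u ∩ ⊤) ∣
      separating u v u≢v rewrite ∩-identityʳ (N[_] G u) | ∩-identityʳ (N[_] G v)
        with adj G u v Bool.≟ true
      ... | yes u~v = adjacent-separated supports-have-degree≥3 u~v
      ... | no  u≁v = nonadjacent-separated u≢v u≁v

  Acyclic⇒TriangleFree : Acyclic G → TriangleFree
  Acyclic⇒TriangleFree acyclic {u} {v} {w} u~v v~w u~w =
    acyclic (u ∷ v ∷ w ∷ []) (u , w , s≤s (s≤s (s≤s z≤n)) ,
      ((Adj⇒≢ u~v ∷ Adj⇒≢ u~w ∷ []) ∷ (Adj⇒≢ v~w ∷ []) ∷ [] ∷ []) ,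
      (refl , step u~v (step v~w (single w)) , last-cons (last-cons (last-single w))) ,
      Adj-sym u~w)

  Connected⇒has-neighbour : 2 ≤ n → Connected G → ∀ v → ∃ (Adj G v)
  Connected⇒has-neighbour 2≤n connected v with another 2≤n v
  ... | w , w≢v with connected v w
  ... | _ ∷ []    , refl , _          , last-single _ = contradiction refl w≢v
  ... | _ ∷ x ∷ _ , refl , step v~x _ , _             = x , v~x

corollary2 : (n : ℕ) → 4 ≤ n → (T : Graph n) → IsTree T →
    HasRedundantIdentifyingCode T ⇔ (∀ (v : Fin n) → IsSupport T v → 3 ≤ deg T v)
corollary2 n 4≤n T (connected , acyclic) = mk⇔
  (λ (_ , S-code) → IsRedundantIdentifyingCode⇒SupportsHaveDegree≥3 T S-code)
  (λ supports-have-degree≥3 → ⊤ ,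
     ⊤-isRedundantIdentifyingCode T (Acyclic⇒TriangleFree T acyclic)
       (Connected⇒has-neighbour T 2≤n connected) supports-have-degree≥3)
  where
  2≤n : 2 ≤ n
  2≤n = ≤-trans (s≤s (s≤s z≤n)) 4≤n
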